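{- For any $m\in\mathbb{N}$, no overbidding is allowed among $m$-uniform safe strategies: that is, the class $\mathcal{P}_m$ of all $m$-uniform safe bidding strategies is exactly $$\mathcal{P}_m=\Big\{\mathbf{b}=\langle(b_1,q_1),\dots,(b_m,q_m)\rangle:\ b_\ell\le w_{Q_\ell}\ \text{for all } \ell\in[m]\Big\}.$$
   Context: A uniform price auction sells $K$ identical units. A fixed bidder has valuation vector $\mathbf v=(v_1,\dots,v_M)$ with $v_1\ge v_2\ge\dots\ge v_M>0$, where $M\le K$ is the bidder's maximum demand. Define $w_j=\frac1j\sum_{\ell\le j}v_\ell$ for $j\in[M]$. An $m$-uniform bidding strategy is $\mathbf b=\langle(b_1,q_1),\dots,(b_m,q_m)\rangle$ with $b_1>b_2>\dots>b_m>0$, positive integers $q_j$, $Q_j=\sum_{\ell\le j}q_\ell$ ($Q_0=0$) and $Q_m\le M$; it stands for the bid vector consisting of $q_1$ copies of $b_1$, then $q_2$ copies of $b_2$, and so on. Given the competing bids $\boldsymbol\beta_-$ (the multiset of bids of all other bidders), all bids are sorted in non-increasing order and the $K$ highest bids each win one unit (ties broken in favor of the bidder); the bidder's allocation $x$ is the number of its winning bids, the per-unit price $p$ is the $K$-th highest submitted bid, and the bidder's value and payment are $V(\mathbf b;\boldsymbol\beta_-)=\sum_{j\le x}v_j$ and $P(\mathbf b;\boldsymbol\beta_-)=p\cdot x$ (both $0$ if $x=0$). The strategy is RoI feasible for $\boldsymbol\beta_-$ if $V(\mathbf b;\boldsymbol\beta_-)\ge P(\mathbf b;\boldsymbol\beta_-)$,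 and it is called safe if it is RoI feasible for every possible $\boldsymbol\beta_-$. A strategy is overbidding if $b_\ell>w_{Q_\ell}$ for some $\ell$.
   Formalization: The valuations, the bids $b_\ell$ and the competing bids $\boldsymbol\beta_-$ are rational numbers. -}

module Defs where

open import Data.Bool using (Bool; true; false; if_then_else_; not; _∧_; _∨_)
open import Data.Nat as ℕ using (ℕ; zero; suc)
open import Data.Fin using (Fin)
open import Data.Integer using (+_)
open import Data.Rational using (ℚ; 0ℚ; _≤ᵇ_; _+_; _*_; _/_; _≤_; _<_)
open import Data.List using (List; []; _∷_; _++_; take; foldr; replicate; length; map)
open import Data.Vec using (Vec; lookup; toList)
open import Data.Product using (_×_; _,_; proj₁; proj₂)

sumℚ : List ℚ → ℚ
sumℚ = foldr _+_ 0ℚ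

sumℕ : List ℕ → ℕ
sumℕ = foldr ℕ._+_ 0

-- A submitted bid, tagged with whether it belongs to the fixed bidder (true)
-- or to a competing bidder (false).
Tagged : Set
Tagged = ℚ × Bool

-- "x is placed before y" in the non-increasing order of bids, with ties
-- broken in favour of the fixed bidder.
before : Tagged → Tagged → Bool
before (a , oa) (b , ob) =
  not (a ≤ᵇ b) ∨ ((a ≤ᵇ b) ∧ (b ≤ᵇ a) ∧ oa)

insert : Tagged → List Tagged → List Tagged
insert x [] = x ∷ []
insert x (y ∷ ys) = if before x y then x ∷ y ∷ ys else y ∷ insert x ys

sortBids : List Tagged → List Tagged
sortBids = foldr insert []

countOurs : List Tagged → ℕ
countOurs [] = 0
countOurs ((_ , true) ∷ xs) = suc (countOurs xs)
countOurs ((_ , false) ∷ xs) = countOurs xs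

-- k-th element (0-indexed) of a list of bids, 0 if it does not exist.
nthBid : ℕ → List Tagged → ℚ
nthBid _ [] = 0ℚ
nthBid zero ((a , _) ∷ _) = a
nthBid (suc k) (_ ∷ xs) = nthBid k xs

-- The bid vector of an m-uniform strategy <(b_1,q_1),...,(b_m,q_m)>:
-- q_1 copies of b_1, then q_2 copies of b_2, ...
bidVector : ∀ {m} → Vec ℚ m → Vec ℕ m → List ℚ
bidVector {zero} Data.Vec.[] Data.Vec.[] = []
bidVector {suc m} (b Data.Vec.∷ bs) (q Data.Vec.∷ qs) = replicate q b ++ bidVector bs qs

Qsum : ∀ {m} → Vec ℕ m → ℕ → ℕ
Qsum qs j = sumℕ (take j (toList qs))

allSorted : List ℚ → List ℚ → List Tagged
allSorted bs β = sortBids (map (λ a → a , true) bs ++ map (λ a → a , false) β)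

allocation : ℕ → List ℚ → List ℚ → ℕ
allocation K bs β = countOurs (take K (allSorted bs β))

-- Per-unit price: the K-th highest submitted bid (0 if fewer than K bids).
price : ℕ → List ℚ → List ℚ → ℚ
price zero bs β = 0ℚ
price (suc k) bs β = nthBid k (allSorted bs β)

value : ∀ {M} → Vec ℚ M → ℕ → List ℚ → List ℚ → ℚ
value v K bs β = sumℚ (take (allocation K bs β) (toList v))

payment : ℕ → List ℚ → List ℚ → ℚ
payment K bs β = price K bs β * ((+ allocation K bs β) / 1)

RoIFeasible : ∀ {M} → ℕ → Vec ℚ M → List ℚ → List ℚ → Set
RoIFeasible K v bs β = payment K bs β ≤ value v K bs β

Safe : ∀ {M} → ℕ → Vec ℚ M → List ℚ → Set
Safe K v bs = ∀ (β : List ℚ) → Data.List.Relation.Unary.All.All (0ℚ ≤_) β → RoIFeasible K v bs β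
  where import Data.List.Relation.Unary.All

-- w_j = (1/j) Σ_{ℓ ≤ j} v_ℓ  (w_0 := 0, never used)
w : ∀ {M} → Vec ℚ M → ℕ → ℚ
w v zero = 0ℚ
w v (suc k) = ((+ 1) / suc k) * sumℚ (take (suc k) (toList v))

ValidValuation : ∀ {M} → Vec ℚ M → Set
ValidValuation {M} v =
  (∀ (i j : Fin M) → i Data.Fin.≤ j → lookup v j ≤ lookup v i) × (∀ (i : Fin M) → 0ℚ < lookup v i)

ValidStrategy : ℕ → ∀ {m} → Vec ℚ m → Vec ℕ m → Set
ValidStrategy M {m} b q =
  (∀ (i j : Fin m) → i Data.Fin.< j → lookup b j < lookup b i)
  × (∀ (i : Fin m) → 0ℚ < lookup b i)
  × (∀ (i : Fin m) → 1 ℕ.≤ lookup q i)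
  × (Qsum q m ℕ.≤ M)

module Submission where

-- Safe ⇒ no overbidding: fix ℓ and let the competitors submit K − Q_ℓ bids of a value c above every bid of
-- the bidder. These fill the top of the ranking, the bidder's first Q_ℓ bids fill the rest, so it wins Q_ℓ
-- units at price b_ℓ, and RoI feasibility reads Q_ℓ b_ℓ ≤ v_1 + … + v_{Q_ℓ}, i.e. b_ℓ ≤ w_{Q_ℓ}.
--
-- No overbidding ⇒ safe: every winning bid is at least the price p, so if the bidder wins x units it has at
-- least x bids ≥ p. Its bids being sorted, the x-th one is some b_ℓ ≥ p with x ≤ Q_ℓ. Since v is
-- non-increasing, prefix means are non-increasing, so p ≤ b_ℓ ≤ w_{Q_ℓ} ≤ w_x, i.e. p x ≤ v_1 + … + v_x.

open import Data.Bool using (true; false; if_then_else_)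
open import Data.Empty using (⊥-elim)
open import Data.Fin as Fin using (Fin; toℕ; fromℕ<)
open import Data.Fin.Properties using (toℕ-fromℕ<)
import Data.Integer as ℤ
import Data.Integer.Properties as ℤ
open import Data.List using (List; []; _∷_; _++_; [_]; take; drop; length; lookup; map; replicate; foldr)
open import Data.List.Properties
  using (take-suc; length-take; foldr-++; map-replicate; ++-identityʳ; take++drop≡id; map-++; map-∘;
         ++-assoc; length-++; length-replicate; ∷-injectiveˡ; ∷-injectiveʳ)
open import Data.List.Membership.Propositional.Properties using (∈-lookup)
open import Data.List.Relation.Binary.Permutation.Propositional using (_↭_; ↭-refl; ↭-sym; ↭-trans; prep; swap)
open import Data.List.Relation.Binary.Permutation.Propositional.Properties
  using (All-resp-↭) renaming (map⁺ to ↭-map⁺)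
open import Data.List.Relation.Unary.All as All using (All; []; _∷_)
import Data.List.Relation.Unary.All.Properties as All
open import Data.List.Relation.Unary.AllPairs using (AllPairs; []; _∷_)
import Data.List.Relation.Unary.AllPairs.Properties as AllPairs
open import Data.Nat as ℕ using (ℕ; zero; suc; s≤s; z≤n)
import Data.Nat.Coprimality as Coprimality
open import Data.Nat.ListAction using (sum)
open import Data.Nat.ListAction.Properties using (sum-++; sum-↭)
import Data.Nat.Properties as ℕ
open import Data.Product using (_×_; _,_; proj₁; proj₂; ∃-syntax)
open import Data.Rational
  using (ℚ; mkℚ; 0ℚ; 1ℚ; _+_; _*_; _/_; 1/_; _≤_; _<_; _≥_; _≤ᵇ_; Positive; NonZero; +-0-rawMonoid)
open import Data.Rational.Properties
open import Data.Sum using (inj₁; inj₂)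
open import Data.Vec as Vec using (Vec; []; _∷_)
import Data.Vec.Properties as Vec
import Data.Vec.Relation.Unary.All.Properties as VecAll
open import Function using (_∘_; _on_; _⇔_; mk⇔; Equivalence)
open import Relation.Binary.PropositionalEquality hiding ([_])
open import Relation.Nullary using (yes; no)
open import Relation.Nullary.Reflects using (Reflects; ofʸ; ofⁿ; fromEquivalence)
open import Algebra.Definitions.RawMonoid +-0-rawMonoid using () renaming (_×_ to _·_)

open import Defs

·-monoʳ-≤ : ∀ n {a c} → a ≤ c → n · a ≤ n · c
·-monoʳ-≤ zero    a≤c = ≤-refl
·-monoʳ-≤ (suc n) a≤c = +-mono-≤ a≤c (·-monoʳ-≤ n a≤c)

+-cancelʳ-≤ : ∀ a b c → a + c ≤ b + c → a ≤ b
+-cancelʳ-≤ a b c a+c≤b+c with a ≤? b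
... | yes a≤b = a≤b
... | no  a≰b = ⊥-elim (<-irrefl refl (<-≤-trans (+-monoˡ-< c (≰⇒> a≰b)) a+c≤b+c))

·≡*ℕ : ∀ n a → n · a ≡ a * (ℤ.+ n / 1)
·≡*ℕ zero    a = sym (trans (cong (a *_) (↥p/↧p≡p 0ℚ)) (*-zeroʳ a))
·≡*ℕ (suc n) a = begin
  a + n · a                  ≡⟨ cong₂ _+_ (sym (*-identityʳ a)) (·≡*ℕ n a) ⟩
  a * 1ℚ + a * (ℤ.+ n / 1)   ≡⟨ *-distribˡ-+ a 1ℚ (ℤ.+ n / 1) ⟨
  a * (1ℚ + ℤ.+ n / 1)       ≡⟨ cong (a *_) (sym (suc≡1+ n)) ⟩
  a * (ℤ.+ suc n / 1)        ∎
  where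
  open ≡-Reasoning
  suc≡1+ : ∀ n → ℤ.+ suc n / 1 ≡ 1ℚ + ℤ.+ n / 1
  suc≡1+ n = begin
    ℤ.+ suc n / 1  ≡⟨ /-cong (cong (λ i → ℤ.+ 1 ℤ.+ i) (sym (ℤ.*-identityʳ (ℤ.+ n)))) refl ⟩
    1ℚ + n/1       ≡⟨ cong (λ q → 1ℚ + q) (↥p/↧p≡p n/1) ⟨
    1ℚ + ℤ.+ n / 1 ∎
    where n/1 = mkℚ (ℤ.+ n) 0 (Coprimality.sym (Coprimality.1-coprimeTo n))

≤1/*⇔*≤ : ∀ r .{{_ : Positive r}} .{{_ : NonZero r}} {a s} → a ≤ 1/ r * s ⇔ a * r ≤ s
≤1/*⇔*≤ r {a} {s} = mk⇔
  (λ a≤s/r → ≤-trans (*-monoʳ-≤-nonNeg r a≤s/r) (≤-reflexive s/r*r≡s))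
  (λ ar≤s → *-cancelʳ-≤-pos r (≤-trans ar≤s (≤-reflexive (sym s/r*r≡s))))
  where
  instance _ = pos⇒nonNeg r
  s/r*r≡s : 1/ r * s * r ≡ s
  s/r*r≡s = begin
    1/ r * s * r   ≡⟨ cong (_* r) (*-comm (1/ r) s) ⟩
    s * 1/ r * r   ≡⟨ *-assoc s (1/ r) r ⟩
    s * (1/ r * r) ≡⟨ cong (s *_) (*-inverseˡ r) ⟩
    s * 1ℚ         ≡⟨ *-identityʳ s ⟩
    s              ∎
    where open ≡-Reasoning

≤-mean⇔ : ∀ n {a s} → a ≤ (ℤ.+ 1 / suc n) * s ⇔ suc n · a ≤ s
≤-mean⇔ n {a} {s} = mk⇔
  (λ h → subst (_≤ s) (sym ·≡*r) (to (subst (λ t → a ≤ t * s) 1/suc≡1/r h)))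
  (λ h → subst (λ t → a ≤ t * s) (sym 1/suc≡1/r) (from (subst (_≤ s) ·≡*r h)))
  where
  -- the normal form of ℤ.+ suc n / 1, whose inverse is the normal form of ℤ.+ 1 / suc n
  r = mkℚ (ℤ.+ suc n) 0 (Coprimality.sym (Coprimality.1-coprimeTo (suc n)))
  open Equivalence (≤1/*⇔*≤ r {a} {s})
  1/suc≡1/r : ℤ.+ 1 / suc n ≡ 1/ r
  1/suc≡1/r = ↥p/↧p≡p (1/ r)
  ·≡*r : suc n · a ≡ a * r
  ·≡*r = trans (·≡*ℕ (suc n) a) (cong (a *_) (↥p/↧p≡p r))

sumℚ-++ : ∀ xs ys → sumℚ (xs ++ ys) ≡ sumℚ xs + sumℚ ys
sumℚ-++ []       ys = sym (+-identityˡ (sumℚ ys))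
sumℚ-++ (x ∷ xs) ys = trans (cong (λ t → x + t) (sumℚ-++ xs ys)) (sym (+-assoc x (sumℚ xs) (sumℚ ys)))

length·≤sumℚ : ∀ {c xs} → All (c ≤_) xs → length xs · c ≤ sumℚ xs
length·≤sumℚ []           = ≤-refl
length·≤sumℚ (c≤x ∷ c≤xs) = +-mono-≤ c≤x (length·≤sumℚ c≤xs)

take-≥-lookup : ∀ {xs} → AllPairs _≥_ xs → (i : Fin (length xs)) → All (_≥ lookup xs i) (take (toℕ i) xs)
take-≥-lookup (_ ∷ _)          Fin.zero    = []
take-≥-lookup (x≥xs ∷ xs-desc) (Fin.suc i) = All.lookup x≥xs (∈-lookup i) ∷ take-≥-lookup xs-desc i

·≤sumℚ-∷ʳ⁻ : ∀ {x a} ys → All (_≥ x) ys →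
  suc (length ys) · a ≤ sumℚ (ys ++ [ x ]) → length ys · a ≤ sumℚ ys
·≤sumℚ-∷ʳ⁻ {x} {a} ys ys≥x h with ≤-total a x
... | inj₁ a≤x = ≤-trans (·-monoʳ-≤ (length ys) a≤x) (length·≤sumℚ ys≥x)
... | inj₂ x≤a = +-cancelʳ-≤ (length ys · a) (sumℚ ys) a (begin
  length ys · a + a  ≡⟨ +-comm (length ys · a) a ⟩
  a + length ys · a  ≤⟨ h ⟩
  sumℚ (ys ++ [ x ]) ≡⟨ sumℚ-++ ys [ x ] ⟩
  sumℚ ys + (x + 0ℚ) ≡⟨ cong (λ t → sumℚ ys + t) (+-identityʳ x) ⟩
  sumℚ ys + x        ≤⟨ +-monoʳ-≤ (sumℚ ys) x≤a ⟩
  sumℚ ys + a        ∎)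
  where open ≤-Reasoning

prefix-mean-antitone : ∀ {xs a n N} → AllPairs _≥_ xs → n ℕ.≤ N → N ℕ.≤ length xs →
  N · a ≤ sumℚ (take N xs) → n · a ≤ sumℚ (take n xs)
prefix-mean-antitone {N = N} desc n≤N N≤len h with ℕ.m≤n⇒m<n∨m≡n n≤N
... | inj₂ refl = h
prefix-mean-antitone {xs} {a} {N = suc j} desc _ j<len h | inj₁ (s≤s n≤j) =
  prefix-mean-antitone desc n≤j (ℕ.<⇒≤ j<len) j·a≤
  where
  i = fromℕ< j<len
  x = lookup xs i
  |prefix|≡j : length (take j xs) ≡ j
  |prefix|≡j = trans (length-take j xs) (ℕ.m≤n⇒m⊓n≡m (ℕ.<⇒≤ j<len))
  take-suc-j : take (suc j) xs ≡ take j xs ++ [ x ]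
  take-suc-j = subst (λ k → take (suc k) xs ≡ take k xs ++ [ x ]) (toℕ-fromℕ< j<len) (take-suc xs i)
  prefix≥x : All (_≥ x) (take j xs)
  prefix≥x = subst (λ k → All (_≥ x) (take k xs)) (toℕ-fromℕ< j<len) (take-≥-lookup desc i)
  j·a≤ : j · a ≤ sumℚ (take j xs)
  j·a≤ = subst (λ k → k · a ≤ sumℚ (take j xs)) |prefix|≡j (·≤sumℚ-∷ʳ⁻ (take j xs) prefix≥x
           (subst₂ (λ k l → k · a ≤ sumℚ l) (cong suc (sym |prefix|≡j)) take-suc-j h))

ours theirs : ℚ → Tagged
ours a = a , true
theirs a = a , false

≤ᵇ-reflects : ∀ p q → Reflects (p ≤ q) (p ≤ᵇ q)
≤ᵇ-reflects p q = fromEquivalence ≤ᵇ⇒≤ ≤⇒≤ᵇ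

before⇒≥ : ∀ {a b oa ob} → before (a , oa) (b , ob) ≡ true → b ≤ a
before⇒≥ {a} {b} h with a ≤ᵇ b | ≤ᵇ-reflects a b | b ≤ᵇ a | ≤ᵇ-reflects b a
... | false | ofⁿ a≰b | _    | _       = <⇒≤ (≰⇒> a≰b)
... | true  | _       | true | ofʸ b≤a = b≤a

¬before⇒≤ : ∀ {a b oa ob} → before (a , oa) (b , ob) ≡ false → a ≤ b
¬before⇒≤ {a} {b} h with a ≤ᵇ b | ≤ᵇ-reflects a b
... | true | ofʸ a≤b = a≤b

before-ours-ours : ∀ {a b} → b ≤ a → before (ours a) (ours b) ≡ true
before-ours-ours {a} {b} b≤a with a ≤ᵇ b | b ≤ᵇ a | ≤ᵇ-reflects b a
... | false | _     | _       = refl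
... | true  | true  | _       = refl
... | true  | false | ofⁿ b≰a = ⊥-elim (b≰a b≤a)

before-ours-theirs : ∀ {a c} → a < c → before (ours a) (theirs c) ≡ false
before-ours-theirs {a} {c} a<c with a ≤ᵇ c | ≤ᵇ-reflects a c | c ≤ᵇ a | ≤ᵇ-reflects c a
... | false | ofⁿ a≰c | _    | _       = ⊥-elim (a≰c (<⇒≤ a<c))
... | true  | _       | false | _      = refl
... | true  | _       | true | ofʸ c≤a = ⊥-elim (<-irrefl refl (<-≤-trans a<c c≤a))

before-theirs-theirs : ∀ {c} → before (theirs c) (theirs c) ≡ false
before-theirs-theirs {c} with c ≤ᵇ c | ≤ᵇ-reflects c c
... | true  | _       = refl
... | false | ofⁿ c≰c = ⊥-elim (c≰c ≤-refl)

insert-↭ : ∀ x ys → insert x ys ↭ x ∷ ys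
insert-↭ x []       = ↭-refl
insert-↭ x (y ∷ ys) with before x y
... | true  = ↭-refl
... | false = ↭-trans (prep y (insert-↭ x ys)) (swap y x ↭-refl)

sortBids-↭ : ∀ xs → sortBids xs ↭ xs
sortBids-↭ []       = ↭-refl
sortBids-↭ (x ∷ xs) = ↭-trans (insert-↭ x (sortBids xs)) (prep x (sortBids-↭ xs))

Sorted : List Tagged → Set
Sorted = AllPairs (_≥_ on proj₁)

insert-sorted : ∀ x {ys} → Sorted ys → Sorted (insert x ys)
insert-sorted x []                        = [] ∷ []
insert-sorted x@(a , oa) {y@(b , ob) ∷ ys} (y≥ys ∷ ys-sorted) with before x y in e
... | true  = let b≤a = before⇒≥ {a} {b} {oa} {ob} e in
              (b≤a ∷ All.map (λ c≤b → ≤-trans c≤b b≤a) y≥ys) ∷ y≥ys ∷ ys-sorted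
... | false = All-resp-↭ (↭-sym (insert-↭ x ys)) (¬before⇒≤ {a} {b} {oa} {ob} e ∷ y≥ys)
              ∷ insert-sorted x ys-sorted

sortBids-sorted : ∀ xs → Sorted (sortBids xs)
sortBids-sorted []       = []
sortBids-sorted (x ∷ xs) = insert-sorted x (sortBids-sorted xs)

sortBids-theirs : ∀ r c → sortBids (replicate r (theirs c)) ≡ replicate r (theirs c)
sortBids-theirs zero    c = refl
sortBids-theirs (suc r) c = trans (cong (insert (theirs c)) (sortBids-theirs r c)) (insert-theirs r)
  where
  insert-theirs : ∀ r → insert (theirs c) (replicate r (theirs c)) ≡ replicate (suc r) (theirs c)
  insert-theirs zero    = refl
  insert-theirs (suc r) rewrite before-theirs-theirs {c} = cong (theirs c ∷_) (insert-theirs r)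

sortBids-ours : ∀ {xs} → AllPairs _≥_ xs → sortBids (map ours xs) ≡ map ours xs
sortBids-ours []                  = refl
sortBids-ours {x ∷ []}    _       = refl
sortBids-ours {x ∷ y ∷ xs} ((y≤x ∷ _) ∷ desc)
  rewrite sortBids-ours desc | before-ours-ours y≤x = refl

insert-past-theirs : ∀ {a c} r ys → a < c →
  insert (ours a) (replicate r (theirs c) ++ ys) ≡ replicate r (theirs c) ++ insert (ours a) ys
insert-past-theirs zero    ys a<c = refl
insert-past-theirs {c = c} (suc r) ys a<c
  rewrite before-ours-theirs a<c = cong (theirs c ∷_) (insert-past-theirs r ys a<c)

foldr-insert-past-theirs : ∀ {c} r ys {xs} → All (_< c) xs →
  foldr insert (replicate r (theirs c) ++ ys) (map ours xs) ≡ replicate r (theirs c) ++ foldr insert ys (map ours xs)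
foldr-insert-past-theirs r ys []                       = refl
foldr-insert-past-theirs r ys {x ∷ xs} (x<c ∷ xs<c) rewrite foldr-insert-past-theirs r ys xs<c =
  insert-past-theirs r (foldr insert ys (map ours xs)) x<c

allSorted-outbid : ∀ {c} r {xs} → AllPairs _≥_ xs → All (_< c) xs →
  allSorted xs (replicate r c) ≡ replicate r (theirs c) ++ map ours xs
allSorted-outbid {c} r {xs} desc xs<c = begin
  sortBids (map ours xs ++ map theirs (replicate r c))
    ≡⟨ foldr-++ insert [] (map ours xs) _ ⟩
  foldr insert (sortBids (map theirs (replicate r c))) (map ours xs)
    ≡⟨ cong (λ ys → foldr insert (sortBids ys) (map ours xs)) (map-replicate theirs r c) ⟩
  foldr insert (sortBids (replicate r (theirs c))) (map ours xs)
    ≡⟨ cong (λ ys → foldr insert ys (map ours xs)) (trans (sortBids-theirs r c) (sym (++-identityʳ _))) ⟩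
  foldr insert (replicate r (theirs c) ++ []) (map ours xs)
    ≡⟨ foldr-insert-past-theirs r [] xs<c ⟩
  replicate r (theirs c) ++ sortBids (map ours xs)
    ≡⟨ cong (replicate r (theirs c) ++_) (sortBids-ours desc) ⟩
  replicate r (theirs c) ++ map ours xs
    ∎
  where open ≡-Reasoning

countOurs-take-theirs : ∀ r c n ys →
  countOurs (take (r ℕ.+ n) (replicate r (theirs c) ++ ys)) ≡ countOurs (take n ys)
countOurs-take-theirs zero    c n ys = refl
countOurs-take-theirs (suc r) c n ys = countOurs-take-theirs r c n ys

nthBid-theirs : ∀ r c n ys → nthBid (r ℕ.+ n) (replicate r (theirs c) ++ ys) ≡ nthBid n ys
nthBid-theirs zero    c n ys = refl
nthBid-theirs (suc r) c n ys = nthBid-theirs r c n ys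

countOurs-take-ours : ∀ ys a zs → countOurs (take (suc (length ys)) (map ours (ys ++ a ∷ zs))) ≡ suc (length ys)
countOurs-take-ours []       a zs = refl
countOurs-take-ours (_ ∷ ys) a zs = cong suc (countOurs-take-ours ys a zs)

nthBid-ours : ∀ ys a zs → nthBid (length ys) (map ours (ys ++ a ∷ zs)) ≡ a
nthBid-ours []       a zs = refl
nthBid-ours (_ ∷ ys) a zs = nthBid-ours ys a zs

outbid-outcome : ∀ {c} r ys a zs → AllPairs _≥_ (ys ++ a ∷ zs) → All (_< c) (ys ++ a ∷ zs) →
  let bv = ys ++ a ∷ zs ; K = suc (r ℕ.+ length ys) in
  allocation K bv (replicate r c) ≡ suc (length ys) × price K bv (replicate r c) ≡ a
outbid-outcome {c} r ys a zs desc bv<c rewrite allSorted-outbid r desc bv<c =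
  trans (cong (λ k → countOurs (take k outbid)) (sym (ℕ.+-suc r (length ys))))
        (trans (countOurs-take-theirs r c (suc (length ys)) _) (countOurs-take-ours ys a zs)) ,
  trans (nthBid-theirs r c (length ys) _) (nthBid-ours ys a zs)
  where outbid = replicate r (theirs c) ++ map ours (ys ++ a ∷ zs)

-- Bids are counted as sums of 0/1 weights, so that the invariance of sum under permutations
-- transfers counts through the sort.
atLeast : ℚ → ℚ → ℕ
atLeast p a = if p ≤ᵇ a then 1 else 0

oursAtLeast : ℚ → Tagged → ℕ
oursAtLeast p (a , true)  = atLeast p a
oursAtLeast p (a , false) = 0

countOurs≤oursAtLeast : ∀ {p xs} → All (λ x → p ≤ proj₁ x) xs →
  countOurs xs ℕ.≤ sum (map (oursAtLeast p) xs)
countOurs≤oursAtLeast []                             = z≤n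
countOurs≤oursAtLeast {p} {(a , false) ∷ _} (_ ∷ h)  = countOurs≤oursAtLeast h
countOurs≤oursAtLeast {p} {(a , true) ∷ _} (p≤a ∷ h) with p ≤ᵇ a | ≤ᵇ-reflects p a
... | true  | _       = s≤s (countOurs≤oursAtLeast h)
... | false | ofⁿ p≰a = ⊥-elim (p≰a p≤a)

sum-map-take : ∀ (g : Tagged → ℕ) n xs → sum (map g (take n xs)) ℕ.≤ sum (map g xs)
sum-map-take g n xs = begin
  sum (map g (take n xs))                             ≤⟨ ℕ.m≤m+n _ _ ⟩
  sum (map g (take n xs)) ℕ.+ sum (map g (drop n xs)) ≡⟨ sum-++ (map g (take n xs)) _ ⟨
  sum (map g (take n xs) ++ map g (drop n xs))        ≡⟨ cong sum (map-++ g (take n xs) _) ⟨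
  sum (map g (take n xs ++ drop n xs))                ≡⟨ cong (sum ∘ map g) (take++drop≡id n xs) ⟩
  sum (map g xs)                                      ∎
  where open ℕ.≤-Reasoning

sum-map-sortBids : ∀ (g : Tagged → ℕ) xs → sum (map g (sortBids xs)) ≡ sum (map g xs)
sum-map-sortBids g xs = sum-↭ (↭-map⁺ g (sortBids-↭ xs))

oursAtLeast-bids : ∀ p bv β → sum (map (oursAtLeast p) (map ours bv ++ map theirs β)) ≡ sum (map (atLeast p) bv)
oursAtLeast-bids p bv β = begin
  sum (map (oursAtLeast p) (map ours bv ++ map theirs β))
    ≡⟨ cong sum (map-++ (oursAtLeast p) (map ours bv) _) ⟩
  sum (map (oursAtLeast p) (map ours bv) ++ map (oursAtLeast p) (map theirs β))
    ≡⟨ sum-++ (map (oursAtLeast p) (map ours bv)) _ ⟩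
  sum (map (oursAtLeast p) (map ours bv)) ℕ.+ sum (map (oursAtLeast p) (map theirs β))
    ≡⟨ cong₂ ℕ._+_ (cong sum (sym (map-∘ bv))) (theirs-count β) ⟩
  sum (map (atLeast p) bv) ℕ.+ 0
    ≡⟨ ℕ.+-identityʳ _ ⟩
  sum (map (atLeast p) bv)
    ∎
  where
  open ≡-Reasoning
  theirs-count : ∀ β → sum (map (oursAtLeast p) (map theirs β)) ≡ 0
  theirs-count []      = refl
  theirs-count (_ ∷ β) = theirs-count β

nthBid-≤ : ∀ {a} k {xs} → All (λ x → proj₁ x ≤ a) xs → 0ℚ ≤ a → nthBid k xs ≤ a
nthBid-≤ k       []          0≤a = 0≤a
nthBid-≤ zero    (x≤a ∷ _)   _   = x≤a
nthBid-≤ (suc k) (_ ∷ xs≤a) 0≤a = nthBid-≤ k xs≤a 0≤a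

take-≥-nthBid : ∀ {xs} → Sorted xs → All (λ x → 0ℚ ≤ proj₁ x) xs →
  ∀ k → All (λ x → nthBid k xs ≤ proj₁ x) (take (suc k) xs)
take-≥-nthBid []                 _               k       = []
take-≥-nthBid (_ ∷ _)            _               zero    = ≤-refl ∷ []
take-≥-nthBid (x≥xs ∷ xs-sorted) (0≤x ∷ xs≥0) (suc k) =
  nthBid-≤ k x≥xs 0≤x ∷ take-≥-nthBid xs-sorted xs≥0 k

atLeast-below : ∀ {p xs} → All (_< p) xs → sum (map (atLeast p) xs) ≡ 0
atLeast-below []                 = refl
atLeast-below {p} {x ∷ _} (x<p ∷ xs<p) with p ≤ᵇ x | ≤ᵇ-reflects p x
... | false | _       = atLeast-below xs<p
... | true  | ofʸ p≤x = ⊥-elim (<-irrefl refl (<-≤-trans x<p p≤x))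

atLeast-prefix : ∀ {p n xs} → AllPairs _≥_ xs → suc n ℕ.≤ sum (map (atLeast p) xs) →
  ∃[ ys ] ∃[ a ] ∃[ zs ] xs ≡ ys ++ a ∷ zs × length ys ≡ n × p ≤ a
atLeast-prefix {p} {n} {x ∷ xs} (x≥xs ∷ desc) h with p ≤ᵇ x | ≤ᵇ-reflects p x
atLeast-prefix {n = zero} {xs = x ∷ xs} _ _ | true | ofʸ p≤x = [] , x , xs , refl , refl , p≤x
atLeast-prefix {n = suc n} {xs = x ∷ xs} (_ ∷ desc) (s≤s h) | true | _ with atLeast-prefix desc h
... | ys , a , zs , refl , refl , p≤a = x ∷ ys , a , zs , refl , refl , p≤a
atLeast-prefix {xs = x ∷ xs} (x≥xs ∷ _) h | false | ofⁿ p≰x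
  with () ← ℕ.≤-trans h
              (ℕ.≤-reflexive (atLeast-below (All.map (λ y≤x → ≤-<-trans y≤x (≰⇒> p≰x)) x≥xs)))

StrictlyDecreasing : ∀ {m} → Vec ℚ m → Set
StrictlyDecreasing b = ∀ i j → i Fin.< j → Vec.lookup b j < Vec.lookup b i

replicate-pairs : ∀ {A : Set} {R : A → A → Set} {x} n → R x x → AllPairs R (replicate n x)
replicate-pairs zero    _   = []
replicate-pairs (suc n) Rxx = All.replicate⁺ n Rxx ∷ replicate-pairs n Rxx

replicate-++-∷ : ∀ {A : Set} n (x : A) zs → replicate (suc n) x ++ zs ≡ replicate n x ++ x ∷ zs
replicate-++-∷ zero    x zs = refl
replicate-++-∷ (suc n) x zs = cong (x ∷_) (replicate-++-∷ n x zs)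

bidVector-all : ∀ {m} {P : ℚ → Set} (b : Vec ℚ m) (q : Vec ℕ m) →
  (∀ i → P (Vec.lookup b i)) → All P (bidVector b q)
bidVector-all []      []      _ = []
bidVector-all (x ∷ b) (n ∷ q) h = All.++⁺ (All.replicate⁺ n (h Fin.zero)) (bidVector-all b q (h ∘ Fin.suc))

bidVector-descending : ∀ {m} (b : Vec ℚ m) (q : Vec ℕ m) → StrictlyDecreasing b →
  AllPairs _≥_ (bidVector b q)
bidVector-descending []      []      _   = []
bidVector-descending (x ∷ b) (n ∷ q) dec = AllPairs.++⁺ (replicate-pairs n ≤-refl)
  (bidVector-descending b q (λ i j i<j → dec (Fin.suc i) (Fin.suc j) (s≤s i<j)))
  (All.replicate⁺ n (bidVector-all b q (λ i → <⇒≤ (dec Fin.zero (Fin.suc i) (s≤s z≤n)))))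

bidVector-split : ∀ {m} (b : Vec ℚ m) (q : Vec ℕ m) → (∀ i → 1 ℕ.≤ Vec.lookup q i) → ∀ ℓ →
  ∃[ ys ] ∃[ zs ] bidVector b q ≡ ys ++ Vec.lookup b ℓ ∷ zs × suc (length ys) ≡ Qsum q (suc (toℕ ℓ))
bidVector-split (x ∷ b) (suc n ∷ q) _ Fin.zero =
  replicate n x , bidVector b q , replicate-++-∷ n x _ ,
  cong suc (trans (length-replicate n) (sym (ℕ.+-identityʳ n)))
bidVector-split (x ∷ b) (n ∷ q) q≥1 (Fin.suc ℓ) with bidVector-split b q (q≥1 ∘ Fin.suc) ℓ
... | ys , zs , eq , |ys|≡Q =
  replicate n x ++ ys , zs ,
  trans (cong (replicate n x ++_) eq) (sym (++-assoc (replicate n x) ys _)) ,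
  (begin
    suc (length (replicate n x ++ ys))         ≡⟨ cong suc (length-++ (replicate n x)) ⟩
    suc (length (replicate n x) ℕ.+ length ys) ≡⟨ cong (λ k → suc (k ℕ.+ length ys)) (length-replicate n) ⟩
    suc (n ℕ.+ length ys)                      ≡⟨ ℕ.+-suc n (length ys) ⟨
    n ℕ.+ suc (length ys)                      ≡⟨ cong (n ℕ.+_) |ys|≡Q ⟩
    n ℕ.+ Qsum q (suc (toℕ ℓ))                 ∎)
  where open ≡-Reasoning
bidVector-split (x ∷ b) (zero ∷ q) q≥1 Fin.zero with () ← q≥1 Fin.zero

bidVector-position : ∀ {m} (b : Vec ℚ m) (q : Vec ℕ m) ys {a zs} → bidVector b q ≡ ys ++ a ∷ zs →
  ∃[ ℓ ] a ≡ Vec.lookup b ℓ × suc (length ys) ℕ.≤ Qsum q (suc (toℕ ℓ))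
bidVector-position []      []      []      ()
bidVector-position []      []      (_ ∷ _) ()
bidVector-position (x ∷ b) (n ∷ q) ys {a} {zs} = within-block n ys
  where
  within-block : ∀ n ys → replicate n x ++ bidVector b q ≡ ys ++ a ∷ zs →
    ∃[ ℓ ] a ≡ Vec.lookup (x ∷ b) ℓ × suc (length ys) ℕ.≤ Qsum (n ∷ q) (suc (toℕ ℓ))
  within-block zero ys eq with bidVector-position b q ys eq
  ... | ℓ , a≡bℓ , bound = Fin.suc ℓ , a≡bℓ , bound
  within-block (suc n) []       eq = Fin.zero , sym (∷-injectiveˡ eq) , s≤s z≤n
  within-block (suc n) (_ ∷ ys) eq with within-block n ys (∷-injectiveʳ eq)
  ... | ℓ , a≡bℓ , bound = ℓ , a≡bℓ , s≤s bound

Qsum-mono : ∀ {m} (q : Vec ℕ m) (ℓ : Fin m) → Qsum q (suc (toℕ ℓ)) ℕ.≤ Qsum q m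
Qsum-mono (n ∷ q) Fin.zero    = ℕ.+-monoʳ-≤ n z≤n
Qsum-mono (n ∷ q) (Fin.suc ℓ) = ℕ.+-monoʳ-≤ n (Qsum-mono q ℓ)

bidVector-bounded : ∀ {m} (b : Vec ℚ m) (q : Vec ℕ m) → StrictlyDecreasing b →
  (∀ i → 0ℚ < Vec.lookup b i) → ∃[ c ] 0ℚ ≤ c × All (_< c) (bidVector b q)
bidVector-bounded []      []      _   _   = 0ℚ , ≤-refl , []
bidVector-bounded (x ∷ b) (n ∷ q) dec pos = x + 1ℚ , <⇒≤ (<-trans (pos Fin.zero) x<x+1) ,
  bidVector-all (x ∷ b) (n ∷ q) (λ i → ≤-<-trans (≤-head i) x<x+1)
  where
  x<x+1 : x < x + 1ℚ
  x<x+1 = subst (_< x + 1ℚ) (+-identityʳ x) (+-monoʳ-< x (positive⁻¹ 1ℚ))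
  ≤-head : ∀ i → Vec.lookup (x ∷ b) i ≤ x
  ≤-head Fin.zero    = ≤-refl
  ≤-head (Fin.suc i) = <⇒≤ (dec Fin.zero (Fin.suc i) (s≤s z≤n))

toList-descending : ∀ {M} (v : Vec ℚ M) → (∀ i j → i Fin.≤ j → Vec.lookup v j ≤ Vec.lookup v i) →
  AllPairs _≥_ (Vec.toList v)
toList-descending []      _    = []
toList-descending (x ∷ v) desc =
  VecAll.toList⁺ (VecAll.lookup⁻ (λ i → desc Fin.zero (Fin.suc i) z≤n)) ∷
  toList-descending v (λ i j i≤j → desc (Fin.suc i) (Fin.suc j) (s≤s i≤j))

≤w⇒·≤sum : ∀ {M} (v : Vec ℚ M) {a} Q → 1 ℕ.≤ Q → a ≤ w v Q → Q · a ≤ sumℚ (take Q (Vec.toList v))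
≤w⇒·≤sum v (suc n) _ = Equivalence.to (≤-mean⇔ n)

safe⇒no-overbidding : ∀ {K M} → M ℕ.≤ K → (v : Vec ℚ M) → ∀ {m} (b : Vec ℚ m) (q : Vec ℕ m) →
  ValidStrategy M b q → Safe K v (bidVector b q) → ∀ ℓ → Vec.lookup b ℓ ≤ w v (Qsum q (suc (toℕ ℓ)))
safe⇒no-overbidding {K} M≤K v b q (dec , pos , q≥1 , Qm≤M) safe ℓ
  with bidVector-split b q q≥1 ℓ | bidVector-bounded b q dec pos
... | ys , zs , bv≡ , sucn≡Qℓ | c , 0≤c , bv<c =
  subst (λ Q → a ≤ w v Q) sucn≡Qℓ (Equivalence.from (≤-mean⇔ n) (subst (_≤ _) (sym (·≡*ℕ (suc n) a)) roi))
  where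
  n = length ys
  a = Vec.lookup b ℓ
  r = K ℕ.∸ suc n
  K≡ : K ≡ suc (r ℕ.+ n)
  K≡ = trans (sym (ℕ.m∸n+n≡m sucn≤K)) (ℕ.+-suc r n)
    where sucn≤K = ℕ.≤-trans (ℕ.≤-reflexive sucn≡Qℓ) (ℕ.≤-trans (Qsum-mono q ℓ) (ℕ.≤-trans Qm≤M M≤K))
  outcome = outbid-outcome r ys a zs (subst (AllPairs _≥_) bv≡ (bidVector-descending b q dec))
                                     (subst (All (_< c)) bv≡ bv<c)
  roi : a * (ℤ.+ suc n / 1) ≤ sumℚ (take (suc n) (Vec.toList v))
  roi = subst₂ (λ x p → p * (ℤ.+ x / 1) ≤ sumℚ (take x (Vec.toList v))) (proj₁ outcome) (proj₂ outcome)
          (subst₂ (λ K bv → RoIFeasible K v bv (replicate r c)) K≡ bv≡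
            (safe (replicate r c) (All.replicate⁺ r 0≤c)))

roi-bound : ∀ {M} (v : Vec ℚ M) → AllPairs _≥_ (Vec.toList v) →
  ∀ {m} (b : Vec ℚ m) (q : Vec ℕ m) → Qsum q m ℕ.≤ M → StrictlyDecreasing b →
  (∀ ℓ → Vec.lookup b ℓ ≤ w v (Qsum q (suc (toℕ ℓ)))) →
  ∀ p x → x ℕ.≤ sum (map (atLeast p) (bidVector b q)) → p * (ℤ.+ x / 1) ≤ sumℚ (take x (Vec.toList v))
roi-bound v v-desc b q Qm≤M dec no-overbid p zero    _ = ≤-reflexive (*-zeroʳ p)
roi-bound v v-desc b q Qm≤M dec no-overbid p (suc n) h
  with atLeast-prefix {p = p} (bidVector-descending b q dec) h
... | ys , a , zs , bv≡ , refl , p≤a with bidVector-position b q ys bv≡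
... | ℓ , refl , sucn≤Qℓ = begin
  p * (ℤ.+ suc n / 1)                ≡⟨ ·≡*ℕ (suc n) p ⟨
  suc n · p                          ≤⟨ ·-monoʳ-≤ (suc n) p≤a ⟩
  suc n · a                          ≤⟨ prefix-mean-antitone v-desc sucn≤Qℓ Qℓ≤len
                                          (≤w⇒·≤sum v Qℓ (ℕ.≤-trans (s≤s z≤n) sucn≤Qℓ) (no-overbid ℓ)) ⟩
  sumℚ (take (suc n) (Vec.toList v)) ∎
  where
  open ≤-Reasoning
  Qℓ = Qsum q (suc (toℕ ℓ))
  Qℓ≤len : Qℓ ℕ.≤ length (Vec.toList v)
  Qℓ≤len = ℕ.≤-trans (Qsum-mono q ℓ) (ℕ.≤-trans Qm≤M (ℕ.≤-reflexive (sym (Vec.length-toList v))))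

no-overbidding⇒safe : ∀ K {M} (v : Vec ℚ M) → ValidValuation v → ∀ {m} (b : Vec ℚ m) (q : Vec ℕ m) →
  ValidStrategy M b q → (∀ ℓ → Vec.lookup b ℓ ≤ w v (Qsum q (suc (toℕ ℓ)))) → Safe K v (bidVector b q)
no-overbidding⇒safe zero    v _ b q _ _ β _ = ≤-reflexive (*-zeroˡ (ℤ.+ 0 / 1))
no-overbidding⇒safe (suc k) v (v-desc , _) b q (dec , pos , _ , Qm≤M) no-overbid β β≥0 =
  roi-bound v (toList-descending v v-desc) b q Qm≤M dec no-overbid p x x≤count
  where
  bv = bidVector b q
  bids = map ours bv ++ map theirs β
  sorted = sortBids bids
  p = nthBid k sorted
  x = countOurs (take (suc k) sorted)
  bids≥0 : All (λ t → 0ℚ ≤ proj₁ t) bids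
  bids≥0 = All.++⁺ (All.map⁺ (bidVector-all b q (<⇒≤ ∘ pos))) (All.map⁺ β≥0)
  x≤count : x ℕ.≤ sum (map (atLeast p) bv)
  x≤count = begin
    x                                               ≤⟨ countOurs≤oursAtLeast (take-≥-nthBid (sortBids-sorted bids)
                                                         (All-resp-↭ (↭-sym (sortBids-↭ bids)) bids≥0) k) ⟩
    sum (map (oursAtLeast p) (take (suc k) sorted)) ≤⟨ sum-map-take (oursAtLeast p) (suc k) sorted ⟩
    sum (map (oursAtLeast p) sorted)                ≡⟨ sum-map-sortBids (oursAtLeast p) bids ⟩
    sum (map (oursAtLeast p) bids)                  ≡⟨ oursAtLeast-bids p bv β ⟩
    sum (map (atLeast p) bv)                        ∎
    where open ℕ.≤-Reasoning

mainTheorem1 : (K M : ℕ) → M ℕ.≤ K → (v : Vec ℚ M) → ValidValuation v →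
    (m : ℕ) → (b : Vec ℚ m) → (q : Vec ℕ m) → ValidStrategy M b q →
      (Safe K v (bidVector b q) → ∀ (ℓ : Fin m) → Vec.lookup b ℓ ≤ w v (Qsum q (suc (toℕ ℓ))))
      × ((∀ (ℓ : Fin m) → Vec.lookup b ℓ ≤ w v (Qsum q (suc (toℕ ℓ)))) → Safe K v (bidVector b q))
mainTheorem1 K M M≤K v valid-v m b q valid-b =
  safe⇒no-overbidding M≤K v b q valid-b , no-overbidding⇒safe K v valid-v b q valid-b
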